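{- Let $a$ and $b$ be positive integers and define $p_{a,b}\colon\mathbb{N}^2\to\mathbb{N}$ by \[ p_{a,b}(x,y)=\begin{cases} y\bigl\lfloor\sqrt[b]{y}\,\bigr\rfloor^a+x &\text{if } \bigl\lfloor\sqrt[b]{y}\,\bigr\rfloor>\bigl\lfloor\sqrt[a]{x}\,\bigr\rfloor,\\ x\Bigl(\bigl\lfloor\sqrt[a]{x}\,\bigr\rfloor+1\Bigr)^{b}+y &\text{otherwise}. \end{cases} \] Then for every integer $n>1$, $p_{a,b}$ is a base-$n$ proportional pairing function with constants of proportionality $a$ and $b$; that is, $p_{a,b}$ is a bijection from $\mathbb{N}^2$ to $\mathbb{N}$ and, for all non-negative integers $x,y,k$, if $\operatorname{len}_n(x)\le ak$ and $\operatorname{len}_n(y)\le bk$ then $\operatorname{len}_n(p_{a,b}(x,y))\le ak+bk$.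
   Context: $\mathbb{N}$ denotes the set of non-negative integers. For an integer $n>1$ and $x\in\mathbb{N}$, $\operatorname{len}_n(x)=\lceil\log_n(x+1)\rceil$ is the number of digits of the base-$n$ representation of $x$ (so $\operatorname{len}_n(0)=0$). A pairing function is a bijection $\mathbb{N}^2\to\mathbb{N}$. For positive integers $a,b$ and an integer $n>1$, a pairing function $f$ is called base-$n$ proportional with constants of proportionality $a$ and $b$ if for all non-negative integers $x,y,k$, $\operatorname{len}_n(x)\le ak$ and $\operatorname{len}_n(y)\le bk$ together imply $\operatorname{len}_n(f(x,y))\le ak+bk$. -}

module Defs where

open import Data.Nat using (ℕ; zero; suc; _+_; _*_; _^_; _≤_; _<_; _≤?_; _<?_)
open import Data.Product using (_×_; _,_)
open import Relation.Nullary.Decidable using (yes; no)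
open import Function.Definitions using (Bijective)
open import Relation.Binary.PropositionalEquality using (_≡_)

rootAux : ℕ → ℕ → ℕ → ℕ
rootAux k y zero = zero
rootAux k y (suc r) with suc r ^ k ≤? y
... | yes _ = suc r
... | no  _ = rootAux k y r

-- ⌊ y^(1/k) ⌋ for k ≥ 1 : the largest r with r ^ k ≤ y (such r is ≤ y)
iroot : ℕ → ℕ → ℕ
iroot k y = rootAux k y y

lenAux : ℕ → ℕ → ℕ → ℕ → ℕ
lenAux n x d zero = d
lenAux n x d (suc fuel) with x <? n ^ d
... | yes _ = d
... | no  _ = lenAux n x (suc d) fuel

-- len n x = ⌈ log_n (x+1) ⌉ = least d with x < n ^ d (number of base-n digits), for n > 1
len : ℕ → ℕ → ℕ
len n x = lenAux n x zero (suc x)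

pab : ℕ → ℕ → ℕ → ℕ → ℕ
pab a b x y with suc (iroot a x) ≤? iroot b y
... | yes _ = y * iroot b y ^ a + x
... | no  _ = x * suc (iroot a x) ^ b + y

IsPairing : (ℕ → ℕ → ℕ) → Set
IsPairing f = Bijective {A = ℕ × ℕ} {B = ℕ} _≡_ _≡_ (λ { (x , y) → f x y })

IsProportional : ℕ → ℕ → ℕ → (ℕ → ℕ → ℕ) → Set
IsProportional n a b f =
  IsPairing f ×
  (∀ x y k → len n x ≤ a * k → len n y ≤ b * k → len n (f x y) ≤ a * k + b * k)

module Submission where

-- Fix a, b > 0 and write p = pab a b.  Shell m is the interval
-- [m^(a+b), (m+1)^(a+b)); it is split at threshold m = m^a·(m+1)^b into a
-- lower block, holding the numbers y·m^a + x with x < m^a and ⌊y^(1/b)⌋ = m,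
-- and an upper block, holding the numbers x·(m+1)^b + y with ⌊x^(1/a)⌋ = m
-- and y < (m+1)^b.  `Code m x y z` says that z spells (x, y) in this mixed
-- radix inside shell m.  We show that p x y always has a code (pab-code),
-- that any code of z forces p x y = z (code-pab), that a code of z lies in
-- shell m (code-root), so that z determines m, then the block, then (x, y)
-- by uniqueness of Euclidean division (code-unique), and that every z has a
-- code (decode-in-shell).  Hence p is a bijection.  For proportionality, x < N^a and
-- y < N^b force m < N, so p x y < (m+1)^(a+b) ≤ N^(a+b) (pab-bound); with
-- N = n^k this is the length bound, since len n z ≤ e iff z < n^e.

open import Defs
open import Data.Nat using (ℕ; _<_; _>_)
open import Data.Nat.Base using (zero; suc; _+_; _*_; _^_; _≤_; z≤n; z<s; NonZero; >-nonZero)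
open import Data.Nat.DivMod using (_/_; _%_; m≡m%n+[m/n]*n; m%n<n)
open import Data.Nat.Properties
open import Data.Product using (Σ; _×_; _,_; proj₂)
open import Data.Empty using (⊥-elim)
open import Relation.Nullary using (yes; no)
open import Function.Definitions using (Injective; Surjective)
open import Relation.Binary using (tri<; tri≈; tri>)
open import Relation.Binary.PropositionalEquality using (_≡_; refl; sym; trans; cong; cong₂; subst)

+-rem-< : ∀ q {d r} → r < d → q * d + r < suc q * d
+-rem-< q {d} {r} r<d = subst (q * d + r <_) (+-comm (q * d) d) (+-monoʳ-< (q * d) r<d)

quotient-lower : ∀ {z} q d {r L} → z ≡ q * d + r → L ≤ q → L * d ≤ z
quotient-lower q d {r} refl L≤q = ≤-trans (*-monoˡ-≤ d L≤q) (m≤m+n (q * d) r)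

quotient-upper : ∀ {z} q d {r U} → z ≡ q * d + r → r < d → q < U → z < U * d
quotient-upper q d refl r<d q<U = <-≤-trans (+-rem-< q r<d) (*-monoˡ-≤ d q<U)

divmod-unique : ∀ {q q' d r r'} → r < d → r' < d → q * d + r ≡ q' * d + r' → q ≡ q' × r ≡ r'
divmod-unique {q} {q'} {d} {r} {r'} r<d r'<d eq with <-cmp q q'
... | tri< q<q' _ _ = ⊥-elim (<-irrefl eq (<-≤-trans (quotient-upper q d refl r<d q<q') (m≤m+n (q' * d) r')))
... | tri> _ _ q'<q = ⊥-elim (<-irrefl (sym eq) (<-≤-trans (quotient-upper q' d refl r'<d q'<q) (m≤m+n (q * d) r)))
... | tri≈ _ refl _ = refl , +-cancelˡ-≡ (q * d) r r' eq

divide : ∀ {z d L U} → L * d ≤ z → z < U * d →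
         Σ ℕ λ q → Σ ℕ λ r → z ≡ q * d + r × r < d × L ≤ q × q < U
divide {z} {zero} {U = U} _ z<U*0 = ⊥-elim (n≮0 (subst (z <_) (*-zeroʳ U) z<U*0))
divide {z} {d@(suc _)} {L} {U} Ld≤z z<Ud = z / d , z % d , z≡qd+r , r<d , L≤q , q<U
  where
  r<d : z % d < d
  r<d = m%n<n z d
  z≡qd+r : z ≡ z / d * d + z % d
  z≡qd+r = trans (m≡m%n+[m/n]*n z d) (+-comm (z % d) (z / d * d))
  L≤q : L ≤ z / d
  L≤q = <⇒≤pred (*-cancelʳ-< d L (suc (z / d)) (≤-<-trans Ld≤z (quotient-upper (z / d) d z≡qd+r r<d ≤-refl)))
  q<U : z / d < U
  q<U = *-cancelʳ-< d (z / d) U (≤-<-trans (quotient-lower (z / d) d z≡qd+r ≤-refl) z<Ud)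

record IsRoot (k y r : ℕ) : Set where
  constructor root
  field
    pow≤ : r ^ k ≤ y
    <pow : y < suc r ^ k

open IsRoot using (<pow)

^-cancelˡ-< : ∀ k {r m} → r ^ k < m ^ k → r < m
^-cancelˡ-< k r^k<m^k = ≰⇒> λ m≤r → <⇒≱ r^k<m^k (^-monoˡ-≤ k m≤r)

root-< : ∀ {k y r m} → IsRoot k y r → y < m ^ k → r < m
root-< {k} (root r^k≤y _) y<m^k = ^-cancelˡ-< k (≤-<-trans r^k≤y y<m^k)

root-unique : ∀ {k y r s} → IsRoot k y r → IsRoot k y s → r ≡ s
root-unique r-root s-root =
  ≤-antisym (<⇒≤pred (root-< r-root (<pow s-root))) (<⇒≤pred (root-< s-root (<pow r-root)))

rootAux-isRoot : ∀ k y R → 0 < k → y < suc R ^ k → IsRoot k y (rootAux k y R)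
rootAux-isRoot (suc k) y zero _ y<1 = root z≤n y<1
rootAux-isRoot k y (suc R) 0<k y<R+2^k with suc R ^ k ≤? y
... | yes R+1^k≤y = root R+1^k≤y y<R+2^k
... | no  R+1^k≰y = rootAux-isRoot k y R 0<k (≰⇒> R+1^k≰y)

-- iroot computes the integer root, searching down from y ≥ ⌊y^(1/k)⌋.
iroot-isRoot : ∀ k y → 0 < k → IsRoot k y (iroot k y)
iroot-isRoot k y 0<k = rootAux-isRoot k y y 0<k
  (<-≤-trans (subst (y <_) (sym (*-identityʳ (suc y))) ≤-refl) (^-monoʳ-≤ (suc y) 0<k))

module Shells (a b : ℕ) (0<a : 0 < a) (0<b : 0 < b) where

  a-root : ∀ x → IsRoot a x (iroot a x)
  a-root x = iroot-isRoot a x 0<a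

  b-root : ∀ y → IsRoot b y (iroot b y)
  b-root y = iroot-isRoot b y 0<b

  data Code (m x y z : ℕ) : Set where
    lower : z ≡ y * m ^ a + x → x < m ^ a → IsRoot b y m → Code m x y z
    upper : z ≡ x * suc m ^ b + y → IsRoot a x m → y < suc m ^ b → Code m x y z

  -- Where the lower block of shell m ends and the upper one begins.
  threshold : ℕ → ℕ
  threshold m = m ^ a * suc m ^ b

  lower-below : ∀ {m x y z} → z ≡ y * m ^ a + x → x < m ^ a → IsRoot b y m → z < threshold m
  lower-below {m} {x} {y} {z} z≡ x<m^a (root _ y<) =
    subst (z <_) (*-comm (suc m ^ b) (m ^ a)) (quotient-upper y (m ^ a) z≡ x<m^a y<)

  upper-above : ∀ {m x y z} → z ≡ x * suc m ^ b + y → IsRoot a x m → threshold m ≤ z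
  upper-above {m} {x} z≡ (root m^a≤x _) = quotient-lower x (suc m ^ b) z≡ m^a≤x

  -- p x y is coded in the shell of the larger of the two roots.
  pab-code : ∀ x y → Σ ℕ λ m → Code m x y (pab a b x y)
  pab-code x y with suc (iroot a x) ≤? iroot b y
  ... | yes rx<ry = iroot b y , lower refl (<-≤-trans (<pow (a-root x)) (^-monoˡ-≤ a rx<ry)) (b-root y)
  ... | no  rx≮ry = iroot a x , upper refl (a-root x) (<-≤-trans (<pow (b-root y)) (^-monoˡ-≤ b (≰⇒> rx≮ry)))

  -- Conversely, a code determines the branch taken by p, hence its value.
  code-pab : ∀ {m x y z} → Code m x y z → pab a b x y ≡ z
  code-pab {x = x} {y} (lower z≡ x<m^a y-root) with suc (iroot a x) ≤? iroot b y
  ... | yes _ = trans (cong (λ r → y * r ^ a + x) (root-unique (b-root y) y-root)) (sym z≡)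
  ... | no rx≮ry = ⊥-elim (rx≮ry (subst (suc (iroot a x) ≤_) (root-unique y-root (b-root y)) (root-< (a-root x) x<m^a)))
  code-pab {x = x} {y} (upper z≡ x-root y<) with suc (iroot a x) ≤? iroot b y
  ... | yes rx<ry = ⊥-elim (<⇒≱ (root-< (b-root y) y<) (subst (λ r → suc r ≤ iroot b y) (root-unique (a-root x) x-root) rx<ry))
  ... | no _ = trans (cong (λ r → x * suc r ^ b + y) (root-unique (a-root x) x-root)) (sym z≡)

  shell-lower : ∀ {m x y z} → Code m x y z → m ^ a * m ^ b ≤ z
  shell-lower {m} {y = y} {z} (lower z≡ _ (root m^b≤y _)) =
    subst (_≤ z) (*-comm (m ^ b) (m ^ a)) (quotient-lower y (m ^ a) z≡ m^b≤y)
  shell-lower {m} (upper z≡ x-root _) = ≤-trans (*-monoʳ-≤ (m ^ a) (^-monoˡ-≤ b (n≤1+n m))) (upper-above z≡ x-root)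

  shell-upper : ∀ {m x y z} → Code m x y z → z < suc m ^ a * suc m ^ b
  shell-upper {m} (lower z≡ x<m^a y-root) = <-≤-trans (lower-below z≡ x<m^a y-root) (*-monoˡ-≤ (suc m ^ b) (^-monoˡ-≤ a (n≤1+n m)))
  shell-upper {m} {x} (upper z≡ (root _ x<) y<) = quotient-upper x (suc m ^ b) z≡ y< x<

  code-root : ∀ {m x y z} → Code m x y z → IsRoot (a + b) z m
  code-root {m} {z = z} c = root (subst (_≤ z) (sym (^-distribˡ-+-* m a b)) (shell-lower c))
                                (subst (z <_) (sym (^-distribˡ-+-* (suc m) a b)) (shell-upper c))

  code-unique-in-shell : ∀ {m x y x' y' z} → Code m x y z → Code m x' y' z → x ≡ x' × y ≡ y'
  code-unique-in-shell (lower z≡ x< _) (lower z≡' x<' _) =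
    let (y≡y' , x≡x') = divmod-unique x< x<' (trans (sym z≡) z≡') in x≡x' , y≡y'
  code-unique-in-shell (upper z≡ _ y<) (upper z≡' _ y<') = divmod-unique y< y<' (trans (sym z≡) z≡')
  code-unique-in-shell (lower z≡ x< y-root) (upper z≡' x-root' _) =
    ⊥-elim (<⇒≱ (lower-below z≡ x< y-root) (upper-above z≡' x-root'))
  code-unique-in-shell (upper z≡ x-root _) (lower z≡' x<' y-root') =
    ⊥-elim (<⇒≱ (lower-below z≡' x<' y-root') (upper-above z≡ x-root))

  code-unique : ∀ {m m' x y x' y' z} → Code m x y z → Code m' x' y' z → x ≡ x' × y ≡ y'
  code-unique {m} {m'} c c' with root-unique {r = m} {s = m'} (code-root c) (code-root c')
  ... | refl = code-unique-in-shell c c'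

  -- Every z has a code in the shell given by its (a+b)-th root: divide by
  -- m^a below the threshold and by (m+1)^b above it.
  decode-in-shell : ∀ {m z} → IsRoot (a + b) z m → Σ ℕ λ x → Σ ℕ λ y → Code m x y z
  decode-in-shell {m} {z} (root m^[a+b]≤z z<) with z <? threshold m
  ... | yes z<T =
    let (y , x , z≡ , x<m^a , m^b≤y , y<) =
          divide (subst (_≤ z) (trans (^-distribˡ-+-* m a b) (*-comm (m ^ a) (m ^ b))) m^[a+b]≤z)
                 (subst (z <_) (*-comm (m ^ a) (suc m ^ b)) z<T)
    in x , y , lower z≡ x<m^a (root m^b≤y y<)
  ... | no z≮T =
    let (x , y , z≡ , y< , m^a≤x , x<) =
          divide (≮⇒≥ z≮T) (subst (z <_) (^-distribˡ-+-* (suc m) a b) z<)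
    in x , y , upper z≡ (root m^a≤x x<) y<

  pab-injective : ∀ {x y x' y'} → pab a b x y ≡ pab a b x' y' → x ≡ x' × y ≡ y'
  pab-injective {x} {y} {x'} {y'} eq =
    code-unique (proj₂ (pab-code x y)) (subst (Code _ x' y') (sym eq) (proj₂ (pab-code x' y')))

  pab-surjective : ∀ z → Σ ℕ λ x → Σ ℕ λ y → pab a b x y ≡ z
  pab-surjective z =
    let (x , y , c) = decode-in-shell (iroot-isRoot (a + b) z (≤-trans 0<a (m≤m+n a b)))
    in x , y , code-pab c

  pab-pairing : IsPairing (pab a b)
  pab-pairing = injective , surjective
    where
    injective : Injective _≡_ _≡_ (λ { (x , y) → pab a b x y })
    injective {_ , _} {_ , _} eq = let (x≡x' , y≡y') = pab-injective eq in cong₂ _,_ x≡x' y≡y'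
    surjective : Surjective _≡_ _≡_ (λ { (x , y) → pab a b x y })
    surjective z = let (x , y , eq) = pab-surjective z in (x , y) , λ { refl → eq }

  code-index-< : ∀ {N m x y z} → Code m x y z → x < N ^ a → y < N ^ b → m < N
  code-index-< (lower _ _ y-root) _ y<N^b = root-< y-root y<N^b
  code-index-< (upper _ x-root _) x<N^a _ = root-< x-root x<N^a

  -- Hence p maps such pairs below N^(a+b), the end of shell N - 1.
  pab-bound : ∀ {N x y} → x < N ^ a → y < N ^ b → pab a b x y < N ^ (a + b)
  pab-bound {N} {x} {y} x< y< =
    let (m , c) = pab-code x y
    in <-≤-trans (<pow (code-root c)) (^-monoˡ-≤ (a + b) (code-index-< c x< y<))

lenAux-bound : ∀ n x d fuel → x < n ^ (d + fuel) → x < n ^ lenAux n x d fuel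
lenAux-bound n x d zero x< = subst (λ e → x < n ^ e) (+-identityʳ d) x<
lenAux-bound n x d (suc fuel) x< with x <? n ^ d
... | yes x<n^d = x<n^d
... | no  _     = lenAux-bound n x (suc d) fuel (subst (λ e → x < n ^ e) (+-suc d fuel) x<)

lenAux-least : ∀ n x d fuel e → x < n ^ e → d ≤ e → lenAux n x d fuel ≤ e
lenAux-least n x d zero e _ d≤e = d≤e
lenAux-least n x d (suc fuel) e x<n^e d≤e with x <? n ^ d
... | yes _      = d≤e
... | no  x≮n^d = lenAux-least n x (suc d) fuel e x<n^e (≤∧≢⇒< d≤e λ { refl → x≮n^d x<n^e })

module Length (n : ℕ) (1<n : 1 < n) where

  instance
    n≢0 : NonZero n
    n≢0 = >-nonZero (<-trans z<s 1<n)

  -- x needs at most x digits; this makes the fuel of len sufficient.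
  <-^ : ∀ x → x < n ^ x
  <-^ zero = z<s
  <-^ (suc x) = ≤-<-trans (<-^ x) (^-monoʳ-< n 1<n (n<1+n x))

  len-≤⇒< : ∀ {x e} → len n x ≤ e → x < n ^ e
  len-≤⇒< {x} len≤e = <-≤-trans (lenAux-bound n x 0 (suc x) (<-trans (n<1+n x) (<-^ (suc x))))
                                 (^-monoʳ-≤ n len≤e)

  <⇒len-≤ : ∀ {x e} → x < n ^ e → len n x ≤ e
  <⇒len-≤ {x} {e} x<n^e = lenAux-least n x 0 (suc x) e x<n^e z≤n

pow-of-pow : ∀ n k c → (n ^ k) ^ c ≡ n ^ (c * k)
pow-of-pow n k c = trans (^-*-assoc n k c) (cong (n ^_) (*-comm k c))

theorem5p5 : (a b : ℕ) → 0 < a → 0 < b → (n : ℕ) → n > 1 →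
    IsProportional n a b (pab a b)
theorem5p5 a b 0<a 0<b n 1<n = pab-pairing , proportional
  where
  open Shells a b 0<a 0<b
  open Length n 1<n

  -- With N = n^k the length hypotheses say x < N^a and y < N^b.
  proportional : ∀ x y k → len n x ≤ a * k → len n y ≤ b * k → len n (pab a b x y) ≤ a * k + b * k
  proportional x y k lenx≤ leny≤ = <⇒len-≤ (subst (pab a b x y <_) N^[a+b]≡ (pab-bound x< y<))
    where
    x< : x < (n ^ k) ^ a
    x< = subst (x <_) (sym (pow-of-pow n k a)) (len-≤⇒< lenx≤)
    y< : y < (n ^ k) ^ b
    y< = subst (y <_) (sym (pow-of-pow n k b)) (len-≤⇒< leny≤)
    N^[a+b]≡ : (n ^ k) ^ (a + b) ≡ n ^ (a * k + b * k)
    N^[a+b]≡ = trans (pow-of-pow n k (a + b)) (cong (n ^_) (*-distribʳ-+ k a b))
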